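{- Let \(D\) be a \(\mathcal V\)-dcpo with a small basis \(\beta : B \to D\). Then \((B,\ll_\beta)\), where \(b \ll_\beta c\) is (a \(\mathcal V\)-valued proposition equivalent to) \(\beta(b)\ll\beta(c)\), is an abstract \(\mathcal V\)-basis, and the map \(D \to \mathrm{Idl}_{\mathcal V}(B,\ll_\beta)\) sending \(x\) to the subset \(\{b \in B \mid \beta(b)\ll x\}\) is an isomorphism of \(\mathcal V\)-dcpos.
   Context: We work constructively and predicatively (no propositional resizing) in univalent foundations with universes and propositional truncation; "there exists" means truncated existence. A type is \(\mathcal V\)-small if equivalent to a type in \(\mathcal V\). A family \(\alpha : I \to D\) into a poset is directed if \(I\) is inhabited and any two indices have (there exists) a common upper index. A \(\mathcal V\)-dcpo is a poset (set carrier, proposition-valued order) with suprema \(\bigsqcup\alpha\) of all directed families indexed by types in \(\mathcal V\). Way-below: \(x\ll y\) iff for every directed \(\alpha:I\to D\), \(I:\mathcal V\), with \(y\sqsubseteq\bigsqcup\alpha\) there exists \(i\) with \(x\sqsubseteq\alpha_i\). A small basis for \(D\) is a map \(\beta : B\to D\) with \(B:\mathcal V\) such that for every \(x:D\) the family \(\Sigma_{b:B}(\beta(b)\ll x)\to D\), \((b,-)\mapsto\beta(b)\), is directed with supremum \(x\), and each proposition \(\beta(b)\ll x\) is \(\mathcal V\)-small. An abstract \(\mathcal V\)-basis is a type \(B:\mathcal V\) with a proposition-valued transitive relation \(\prec : B\to B\to\mathcal V\) such that for every \(a\) there exists \(b\prec a\), and whenever \(a_1,a_2\prec b\) there exists \(a\)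 with \(a_1,a_2\prec a\prec b\). An ideal of \((B,\prec)\) is a subset \(I : B \to \Omega_{\mathcal V}\) that is a lower set (\(a\prec b\in I\) implies \(a\in I\)) and directed (inhabited, and any \(b_1,b_2\in I\) have some \(b\in I\) with \(b_1,b_2\prec b\)). \(\mathrm{Idl}_{\mathcal V}(B,\prec)\) is the type of ideals ordered by inclusion; it is a \(\mathcal V\)-dcpo with directed suprema given by unions. An isomorphism of \(\mathcal V\)-dcpos is an order isomorphism (equivalently, a pair of mutually inverse Scott continuous maps). -}

module Defs where

open import Level using (Level; _⊔_; Setω) renaming (suc to lsuc)
open import Data.Product using (Σ; _×_; _,_; proj₁; proj₂)
open import Relation.Binary.PropositionalEquality using (_≡_)
open import Function.Bundles using (_↔_)
open import Axiom.Extensionality.Propositional using (Extensionality)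

isProp : ∀ {ℓ} → Set ℓ → Set ℓ
isProp A = (x y : A) → x ≡ y

isSet : ∀ {ℓ} → Set ℓ → Set ℓ
isSet A = (x y : A) → isProp (x ≡ y)

isSmall : ∀ {ℓ} (𝓥 : Level) → Set ℓ → Set (lsuc 𝓥 ⊔ ℓ)
isSmall 𝓥 X = Σ (Set 𝓥) (λ Y → Y ↔ X)

FunExt : Setω
FunExt = ∀ {a b} → Extensionality a b

PropExt : (𝓥 : Level) → Set (lsuc 𝓥)
PropExt 𝓥 = {P Q : Set 𝓥} → isProp P → isProp Q → (P → Q) → (Q → P) → P ≡ Q

record PropTrunc : Setω where
  field
    ∥_∥     : ∀ {ℓ} → Set ℓ → Set ℓ
    ∥∥-prop : ∀ {ℓ} {A : Set ℓ} → isProp ∥ A ∥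
    ∣_∣     : ∀ {ℓ} {A : Set ℓ} → A → ∥ A ∥
    ∥∥-rec  : ∀ {ℓ ℓ'} {A : Set ℓ} {P : Set ℓ'} → isProp P → (A → P) → ∥ A ∥ → P

module WithPT (pt : PropTrunc) where
  open PropTrunc pt

  isDirected : ∀ {ℓ 𝓤 𝓣 : Level} {X : Set 𝓤} (_⊑_ : X → X → Set 𝓣)
               {I : Set ℓ} → (I → X) → Set (ℓ ⊔ 𝓣)
  isDirected _⊑_ {I} α =
    ∥ I ∥ × ((i j : I) → ∥ Σ I (λ k → (α i ⊑ α k) × (α j ⊑ α k)) ∥)

  isSup : ∀ {ℓ 𝓤 𝓣 : Level} {X : Set 𝓤} (_⊑_ : X → X → Set 𝓣)
          {I : Set ℓ} → X → (I → X) → Set (ℓ ⊔ 𝓤 ⊔ 𝓣)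
  isSup _⊑_ {I} x α = ((i : I) → α i ⊑ x) × ((u : _) → ((i : I) → α i ⊑ u) → x ⊑ u)

  record DCPO (𝓥 𝓤 𝓣 : Level) : Set (lsuc (𝓥 ⊔ 𝓤 ⊔ 𝓣)) where
    field
      ⟨_⟩      : Set 𝓤
      _⊑_      : ⟨_⟩ → ⟨_⟩ → Set 𝓣
      ⟨⟩-set   : isSet ⟨_⟩
      ⊑-prop   : (x y : ⟨_⟩) → isProp (x ⊑ y)
      ⊑-refl   : (x : ⟨_⟩) → x ⊑ x
      ⊑-trans  : (x y z : ⟨_⟩) → x ⊑ y → y ⊑ z → x ⊑ z
      ⊑-antisym : (x y : ⟨_⟩) → x ⊑ y → y ⊑ x → x ≡ y
      ∐        : {I : Set 𝓥} (α : I → ⟨_⟩) → isDirected _⊑_ α → ⟨_⟩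
      ∐-isSup  : {I : Set 𝓥} (α : I → ⟨_⟩) (δ : isDirected _⊑_ α) → isSup _⊑_ (∐ α δ) α

    _≪_ : ⟨_⟩ → ⟨_⟩ → Set (lsuc 𝓥 ⊔ 𝓤 ⊔ 𝓣)
    x ≪ y = {I : Set 𝓥} (α : I → ⟨_⟩) (δ : isDirected _⊑_ α)
            → y ⊑ ∐ α δ → ∥ Σ I (λ i → x ⊑ α i) ∥

  module _ {𝓥 𝓤 𝓣 : Level} (D : DCPO 𝓥 𝓤 𝓣) where
    open DCPO D

    ↡ι : {B : Set 𝓥} (β : B → ⟨_⟩) (x : ⟨_⟩) → Σ B (λ b → β b ≪ x) → ⟨_⟩
    ↡ι β x (b , _) = β b

    record isSmallBasis {B : Set 𝓥} (β : B → ⟨_⟩) : Set (lsuc 𝓥 ⊔ 𝓤 ⊔ 𝓣) where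
      field
        ↡-directed : (x : ⟨_⟩) → isDirected _⊑_ (↡ι β x)
        ↡-sup      : (x : ⟨_⟩) → isSup _⊑_ x (↡ι β x)
        ≪-small    : (b : B) (x : ⟨_⟩) → isSmall 𝓥 (β b ≪ x)

      _≪ₛ_ : B → ⟨_⟩ → Set 𝓥
      b ≪ₛ x = proj₁ (≪-small b x)

      _≪β_ : B → B → Set 𝓥
      b ≪β c = b ≪ₛ β c

  record isAbstractBasis {𝓥 : Level} (B : Set 𝓥) (_≺_ : B → B → Set 𝓥) : Set 𝓥 where
    field
      ≺-prop   : (a b : B) → isProp (a ≺ b)
      ≺-trans  : (a b c : B) → a ≺ b → b ≺ c → a ≺ c
      ≺-nullary-interpolation : (a : B) → ∥ Σ B (λ b → b ≺ a) ∥
      ≺-binary-interpolation  : (a₁ a₂ b : B) → a₁ ≺ b → a₂ ≺ b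
                                → ∥ Σ B (λ a → (a₁ ≺ a) × (a₂ ≺ a) × (a ≺ b)) ∥

  record Ideal {𝓥 : Level} (B : Set 𝓥) (_≺_ : B → B → Set 𝓥) : Set (lsuc 𝓥) where
    field
      _∈I      : B → Set 𝓥
      ∈-prop   : (b : B) → isProp (b ∈I)
      lower    : (a b : B) → a ≺ b → b ∈I → a ∈I
      inhabited : ∥ Σ B _∈I ∥
      directed : (b₁ b₂ : B) → b₁ ∈I → b₂ ∈I
                 → ∥ Σ B (λ b → (b ∈I) × (b₁ ≺ b) × (b₂ ≺ b)) ∥

  _⊆ᴵ_ : ∀ {𝓥} {B : Set 𝓥} {_≺_ : B → B → Set 𝓥} → Ideal B _≺_ → Ideal B _≺_ → Set 𝓥
  _⊆ᴵ_ {B = B} I J = (b : B) → Ideal._∈I I b → Ideal._∈I J b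

  isOrderIsoToIdl : ∀ {𝓥 𝓤 𝓣} (D : DCPO 𝓥 𝓤 𝓣) {B : Set 𝓥} {_≺_ : B → B → Set 𝓥}
                    → (DCPO.⟨_⟩ D → Ideal B _≺_) → Set (lsuc 𝓥 ⊔ 𝓤 ⊔ 𝓣)
  isOrderIsoToIdl D {B} {_≺_} f =
    Σ (Ideal B _≺_ → ⟨_⟩) λ g →
        ((x y : ⟨_⟩) → x ⊑ y → f x ⊆ᴵ f y)
      × ((I J : Ideal B _≺_) → I ⊆ᴵ J → g I ⊑ g J)
      × ((x : ⟨_⟩) → g (f x) ≡ x)
      × ((I : Ideal B _≺_) → f (g I) ≡ I)
    where open DCPO D

-- Everything rests on interpolation: if x ≪ y then x ≪ β b ≪ y for some basis
-- element b.  It follows by applying x ≪ y to the directed family of all β c with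
-- c ≪ β b ≪ y, whose supremum is y because every element is the supremum of the
-- basis elements way below it.  Interpolation makes (B, ≪β) an abstract basis and
-- makes each {b | β b ≪ x} directed, hence an ideal; the inverse map takes an
-- ideal I to the supremum of β over I.  Going back and forth gives x again since x
-- is the supremum of its basis approximants, and gives I again since I is a rounded
-- lower set: each b ∈ I lies way below some other element of I.
module Submission where

open import Defs
open import Level using (Level)
open import Data.Product using (Σ; _×_; _,_; proj₁; proj₂)
open import Data.Unit.Polymorphic using (⊤; tt)
open import Relation.Binary.PropositionalEquality using (_≡_; refl; sym; cong; module ≡-Reasoning)
open import Function.Bundles using (_↔_; Inverse)
open import Axiom.Extensionality.Propositional using (implicit-extensionality)
open import Axiom.UniquenessOfIdentityProofs using (module Constant⇒UIP)

isProp⇒isSet : ∀ {ℓ} {A : Set ℓ} → isProp A → isSet A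
isProp⇒isSet p _ _ = Constant⇒UIP.≡-irrelevant (λ {x} {y} _ → p x y) (λ _ _ → refl)

isProp-isProp : FunExt → ∀ {ℓ} {A : Set ℓ} → isProp (isProp A)
isProp-isProp fe p q = fe λ x → fe λ y → isProp⇒isSet p x y (p x y) (q x y)

isProp-↔ : ∀ {a b} {A : Set a} {A' : Set b} → A ↔ A' → isProp A' → isProp A
isProp-↔ e p x y = begin
  x           ≡⟨ sym (strictlyInverseʳ x) ⟩
  from (to x) ≡⟨ cong from (p (to x) (to y)) ⟩
  from (to y) ≡⟨ strictlyInverseʳ y ⟩
  y           ∎
  where
  open Inverse e
  open ≡-Reasoning

module Truncation (pt : PropTrunc) where
  open PropTrunc pt

  ∥∥-map : ∀ {a b} {A : Set a} {A' : Set b} → (A → A') → ∥ A ∥ → ∥ A' ∥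
  ∥∥-map h = ∥∥-rec ∥∥-prop (λ a → ∣ h a ∣)

  ∥∥-bind : ∀ {a b} {A : Set a} {A' : Set b} → ∥ A ∥ → (A → ∥ A' ∥) → ∥ A' ∥
  ∥∥-bind a h = ∥∥-rec ∥∥-prop h a

module IdealExtensionality (pt : PropTrunc) (fe : FunExt) {𝓥 : Level} (pe : PropExt 𝓥)
                           {B : Set 𝓥} {_≺_ : B → B → Set 𝓥} where
  open PropTrunc pt
  open WithPT pt

  ∈I-≡⇒≡ : {I J : Ideal B _≺_} → Ideal._∈I I ≡ Ideal._∈I J → I ≡ J
  ∈I-≡⇒≡ {record { ∈-prop = p ; lower = l ; inhabited = i ; directed = d }}
         {record { ∈-prop = p' ; lower = l' ; inhabited = i' ; directed = d' }} refl
    with fe (λ b → isProp-isProp fe (p b) (p' b))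
  ... | refl with fe (λ a → fe λ b → fe λ u → fe λ v → p a (l a b u v) (l' a b u v))
  ... | refl with ∥∥-prop i i'
  ... | refl with fe (λ b₁ → fe λ b₂ → fe λ v₁ → fe λ v₂ → ∥∥-prop (d b₁ b₂ v₁ v₂) (d' b₁ b₂ v₁ v₂))
  ... | refl = refl

  ⊆ᴵ-antisym : (I J : Ideal B _≺_) → I ⊆ᴵ J → J ⊆ᴵ I → I ≡ J
  ⊆ᴵ-antisym I J I⊆J J⊆I =
    ∈I-≡⇒≡ (fe λ b → pe (Ideal.∈-prop I b) (Ideal.∈-prop J b) (I⊆J b) (J⊆I b))

module WayBelow (pt : PropTrunc) {𝓥 𝓤 𝓣 : Level} (D : WithPT.DCPO pt 𝓥 𝓤 𝓣) where
  open PropTrunc pt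
  open WithPT pt
  open DCPO D
  open Truncation pt

  private variable
    I : Set 𝓥
    α : I → ⟨_⟩
    x y z u : ⟨_⟩

  ∐-upper : (δ : isDirected _⊑_ α) (i : I) → α i ⊑ ∐ α δ
  ∐-upper {α = α} δ = proj₁ (∐-isSup α δ)

  ∐-least : (δ : isDirected _⊑_ α) → ((i : I) → α i ⊑ u) → ∐ α δ ⊑ u
  ∐-least {α = α} δ = proj₂ (∐-isSup α δ) _

  const-directed : (x : ⟨_⟩) → isDirected _⊑_ {I = ⊤ {𝓥}} (λ _ → x)
  const-directed x = ∣ tt ∣ , λ _ _ → ∣ tt , ⊑-refl x , ⊑-refl x ∣

  ≪-prop : FunExt → (x y : ⟨_⟩) → isProp (x ≪ y)
  ≪-prop fe x y p q = implicit-extensionality fe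
    (fe λ α → fe λ δ → fe λ y⊑∐α → ∥∥-prop (p α δ y⊑∐α) (q α δ y⊑∐α))

  ≪⇒⊑ : x ≪ y → x ⊑ y
  ≪⇒⊑ {x} {y} x≪y =
    ∥∥-rec (⊑-prop x y) proj₂ (x≪y _ (const-directed y) (∐-upper (const-directed y) tt))

  ≪-⊑-trans : x ≪ y → y ⊑ z → x ≪ z
  ≪-⊑-trans x≪y y⊑z α δ z⊑∐α = x≪y α δ (⊑-trans _ _ _ y⊑z z⊑∐α)

  ⊑-≪-trans : x ⊑ y → y ≪ z → x ≪ z
  ⊑-≪-trans x⊑y y≪z α δ z⊑∐α =
    ∥∥-map (λ { (i , y⊑αi) → i , ⊑-trans _ _ _ x⊑y y⊑αi }) (y≪z α δ z⊑∐α)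

module SmallBasis (pt : PropTrunc) (fe : FunExt) {𝓥 𝓤 𝓣 : Level} (pe : PropExt 𝓥)
                  (D : WithPT.DCPO pt 𝓥 𝓤 𝓣) {B : Set 𝓥} (β : B → WithPT.DCPO.⟨_⟩ D)
                  (sb : WithPT.isSmallBasis pt D β) where
  open PropTrunc pt
  open WithPT pt
  open DCPO D
  open isSmallBasis sb
  open Truncation pt
  open WayBelow pt D
  open IdealExtensionality pt fe pe

  private variable
    a b b₁ b₂ : B
    x y : ⟨_⟩

  ≪ₛ⇒≪ : b ≪ₛ x → β b ≪ x
  ≪ₛ⇒≪ {b} {x} = Inverse.to (proj₂ (≪-small b x))

  ≪⇒≪ₛ : β b ≪ x → b ≪ₛ x
  ≪⇒≪ₛ {b} {x} = Inverse.from (proj₂ (≪-small b x))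

  ≪ₛ-prop : (b : B) (x : ⟨_⟩) → isProp (b ≪ₛ x)
  ≪ₛ-prop b x = isProp-↔ (proj₂ (≪-small b x)) (≪-prop fe (β b) x)

  ≪β⇒⊑ : a ≪β b → β a ⊑ β b
  ≪β⇒⊑ a≪b = ≪⇒⊑ (≪ₛ⇒≪ a≪b)

  ≪ₛ-monoʳ : x ⊑ y → b ≪ₛ x → b ≪ₛ y
  ≪ₛ-monoʳ x⊑y b≪x = ≪⇒≪ₛ (≪-⊑-trans (≪ₛ⇒≪ b≪x) x⊑y)

  ≪ₛ-lower : a ≪β b → b ≪ₛ x → a ≪ₛ x
  ≪ₛ-lower a≪b b≪x = ≪ₛ-monoʳ (≪⇒⊑ (≪ₛ⇒≪ b≪x)) a≪b

  ↡ₛ : (x : ⟨_⟩) → Σ B (_≪ₛ x) → ⟨_⟩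
  ↡ₛ x (b , _) = β b

  ↡ₛ-directed : (x : ⟨_⟩) → isDirected _⊑_ (↡ₛ x)
  ↡ₛ-directed x =
      ∥∥-map (λ { (b , b≪x) → b , ≪⇒≪ₛ b≪x }) (proj₁ (↡-directed x))
    , λ { (b₁ , b₁≪x) (b₂ , b₂≪x) →
          ∥∥-map (λ { ((b , b≪x) , l₁ , l₂) → (b , ≪⇒≪ₛ b≪x) , l₁ , l₂ })
                 (proj₂ (↡-directed x) (b₁ , ≪ₛ⇒≪ b₁≪x) (b₂ , ≪ₛ⇒≪ b₂≪x)) }

  ↡-least : {u : ⟨_⟩} → ((b : B) → β b ≪ x → β b ⊑ u) → x ⊑ u
  ↡-least {x} h = proj₂ (↡-sup x) _ λ { (b , b≪x) → h b b≪x }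

  module Interpolation (y : ⟨_⟩) where

    Approximants² : Set 𝓥
    Approximants² = Σ (Σ B (_≪ₛ y)) λ (b , _) → Σ B (_≪β b)

    γ : Approximants² → ⟨_⟩
    γ (_ , (c , _)) = β c

    γ-directed : isDirected _⊑_ γ
    γ-directed = inhabited , semidirected
      where
      inhabited : ∥ Approximants² ∥
      inhabited = ∥∥-bind (proj₁ (↡ₛ-directed y)) λ p →
                  ∥∥-map (p ,_) (proj₁ (↡ₛ-directed (β (proj₁ p))))

      semidirected : (i j : Approximants²) → ∥ Σ Approximants² (λ k → (γ i ⊑ γ k) × (γ j ⊑ γ k)) ∥
      semidirected (p₁ , (c₁ , c₁≪b₁)) (p₂ , (c₂ , c₂≪b₂)) =
        ∥∥-bind (proj₂ (↡ₛ-directed y) p₁ p₂) λ { (p , l₁ , l₂) →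
        ∥∥-map (λ { (q , m₁ , m₂) → (p , q) , m₁ , m₂ })
               (proj₂ (↡ₛ-directed (β (proj₁ p))) (c₁ , ≪ₛ-monoʳ l₁ c₁≪b₁)
                                                  (c₂ , ≪ₛ-monoʳ l₂ c₂≪b₂)) }

    ⊑∐γ : y ⊑ ∐ γ γ-directed
    ⊑∐γ = ↡-least λ b b≪y → ↡-least λ c c≪b →
      ∐-upper γ-directed ((b , ≪⇒≪ₛ b≪y) , (c , ≪⇒≪ₛ c≪b))

  ≪-interpolation : x ≪ y → ∥ Σ B (λ b → (x ≪ β b) × (β b ≪ y)) ∥
  ≪-interpolation {x} {y} x≪y = ∥∥-map interpolant (x≪y γ γ-directed ⊑∐γ)
    where
    open Interpolation y

    interpolant : Σ Approximants² (λ i → x ⊑ γ i) → Σ B (λ b → (x ≪ β b) × (β b ≪ y))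
    interpolant (((b , b≪y) , (c , c≪b)) , x⊑c) = b , ⊑-≪-trans x⊑c (≪ₛ⇒≪ c≪b) , ≪ₛ⇒≪ b≪y

  ≪ₛ-directed : b₁ ≪ₛ x → b₂ ≪ₛ x → ∥ Σ B (λ b → (b ≪ₛ x) × (b₁ ≪β b) × (b₂ ≪β b)) ∥
  ≪ₛ-directed {x = x} b₁≪x b₂≪x =
    ∥∥-bind (≪-interpolation (≪ₛ⇒≪ b₁≪x)) λ { (c₁ , b₁≪c₁ , c₁≪x) →
    ∥∥-bind (≪-interpolation (≪ₛ⇒≪ b₂≪x)) λ { (c₂ , b₂≪c₂ , c₂≪x) →
    ∥∥-map (λ { ((b , b≪x) , c₁⊑b , c₂⊑b) →
                b , b≪x , ≪⇒≪ₛ (≪-⊑-trans b₁≪c₁ c₁⊑b) , ≪⇒≪ₛ (≪-⊑-trans b₂≪c₂ c₂⊑b) })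
           (proj₂ (↡ₛ-directed x) (c₁ , ≪⇒≪ₛ c₁≪x) (c₂ , ≪⇒≪ₛ c₂≪x)) } }

  ≪β-isAbstractBasis : isAbstractBasis B _≪β_
  ≪β-isAbstractBasis = record
    { ≺-prop                  = λ a b → ≪ₛ-prop a (β b)
    ; ≺-trans                 = λ _ _ _ → ≪ₛ-lower
    ; ≺-nullary-interpolation = λ a → proj₁ (↡ₛ-directed (β a))
    ; ≺-binary-interpolation  = λ _ _ _ a₁≪b a₂≪b →
        ∥∥-map (λ { (a , a≪b , a₁≪a , a₂≪a) → a , a₁≪a , a₂≪a , a≪b }) (≪ₛ-directed a₁≪b a₂≪b)
    }

  Idl : Set _
  Idl = Ideal B _≪β_

  ↡ᴵ : ⟨_⟩ → Idl
  ↡ᴵ x = record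
    { _∈I       = _≪ₛ x
    ; ∈-prop    = λ b → ≪ₛ-prop b x
    ; lower     = λ _ _ → ≪ₛ-lower
    ; inhabited = proj₁ (↡ₛ-directed x)
    ; directed  = λ _ _ → ≪ₛ-directed
    }

  module _ (I : Idl) where
    open Ideal I

    β∈ : Σ B _∈I → ⟨_⟩
    β∈ (b , _) = β b

    β∈-directed : isDirected _⊑_ β∈
    β∈-directed = inhabited , λ { (b₁ , b₁∈I) (b₂ , b₂∈I) →
      ∥∥-map (λ { (b , b∈I , b₁≪b , b₂≪b) → (b , b∈I) , ≪β⇒⊑ b₁≪b , ≪β⇒⊑ b₂≪b })
             (directed b₁ b₂ b₁∈I b₂∈I) }

  ∐ᴵ : Idl → ⟨_⟩
  ∐ᴵ I = ∐ (β∈ I) (β∈-directed I)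

  ↡ᴵ-mono : (x y : ⟨_⟩) → x ⊑ y → ↡ᴵ x ⊆ᴵ ↡ᴵ y
  ↡ᴵ-mono _ _ x⊑y _ = ≪ₛ-monoʳ x⊑y

  ∐ᴵ-mono : (I J : Idl) → I ⊆ᴵ J → ∐ᴵ I ⊑ ∐ᴵ J
  ∐ᴵ-mono I J I⊆J =
    ∐-least (β∈-directed I) λ { (b , b∈I) → ∐-upper (β∈-directed J) (b , I⊆J b b∈I) }

  ∐ᴵ-↡ᴵ : (x : ⟨_⟩) → ∐ᴵ (↡ᴵ x) ≡ x
  ∐ᴵ-↡ᴵ x = ⊑-antisym _ _
    (∐-least (β∈-directed (↡ᴵ x)) λ { (b , b≪x) → ≪⇒⊑ (≪ₛ⇒≪ b≪x) })
    (↡-least λ b b≪x → ∐-upper (β∈-directed (↡ᴵ x)) (b , ≪⇒≪ₛ b≪x))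

  ↡ᴵ-∐ᴵ : (I : Idl) → ↡ᴵ (∐ᴵ I) ≡ I
  ↡ᴵ-∐ᴵ I = ⊆ᴵ-antisym (↡ᴵ (∐ᴵ I)) I ↡∐I⊆I I⊆↡∐I
    where
    open Ideal I

    ↡∐I⊆I : ↡ᴵ (∐ᴵ I) ⊆ᴵ I
    ↡∐I⊆I b b≪∐I =
      ∥∥-rec (∈-prop b) (λ { (c , b≪c , c≪∐I) →
      ∥∥-rec (∈-prop b) (λ { ((d , d∈I) , c⊑d) → lower b d (≪⇒≪ₛ (≪-⊑-trans b≪c c⊑d)) d∈I })
             (c≪∐I (β∈ I) (β∈-directed I) (⊑-refl _)) })
        (≪-interpolation (≪ₛ⇒≪ b≪∐I))

    -- Ideals are rounded: directedness applied to b and b itself yields c ∈ I with b ≪β c.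
    I⊆↡∐I : I ⊆ᴵ ↡ᴵ (∐ᴵ I)
    I⊆↡∐I b b∈I =
      ∥∥-rec (≪ₛ-prop b (∐ᴵ I))
        (λ { (c , c∈I , b≪c , _) → ≪ₛ-monoʳ (∐-upper (β∈-directed I) (c , c∈I)) b≪c })
        (directed b b b∈I b∈I)

theorem6p28 : (pt : PropTrunc) → FunExt → {𝓥 𝓤 𝓣 : Level} → PropExt 𝓥
    → let open WithPT pt in
    (D : DCPO 𝓥 𝓤 𝓣) {B : Set 𝓥} (β : B → DCPO.⟨_⟩ D)
    → (sb : isSmallBasis D β)
    → isAbstractBasis B (isSmallBasis._≪β_ sb)
    × Σ (DCPO.⟨_⟩ D → Ideal B (isSmallBasis._≪β_ sb))
    (λ f → ((x : DCPO.⟨_⟩ D) → Ideal._∈I (f x) ≡ (λ b → isSmallBasis._≪ₛ_ sb b x))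
    × isOrderIsoToIdl D f)
theorem6p28 pt fe pe D β sb =
  ≪β-isAbstractBasis , ↡ᴵ , (λ _ → refl) , ∐ᴵ , ↡ᴵ-mono , ∐ᴵ-mono , ∐ᴵ-↡ᴵ , ↡ᴵ-∐ᴵ
  where open SmallBasis pt fe pe D β sb
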